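{- Let $m\ge2$ and $r\ge1$ be integers, and let $n$ be an integer not divisible by $m$; write $n=tm+\rho$ with integer $t$ and $\rho\in\{1,\dots,m-1\}$. Then $$\omega_m\Big(\frac{n}{m^r}\Big)=\Big(1-\frac{\rho}{m}\Big)\omega_m\Big(\frac{t}{m^{r-1}}\Big)+\frac{\rho}{m}\,\omega_m\Big(\frac{t+1}{m^{r-1}}\Big)+\frac1{m^r}.$$
   Context: For real $x$, $\|x\|$ is the distance from $x$ to the nearest integer, $\|x\|_{\alpha}:=\min\{\|x\|,\alpha\}$, and for an integer $m\ge2$, $\omega_m(x):=\sum_{k=0}^\infty m^{ -k}\|m^kx\|_{1/m}$. -}

module Defs where

open import Data.Nat as ℕ using (ℕ; zero; suc; NonZero)
open import Data.Integer as ℤ using (ℤ; +_)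
open import Data.Rational using (ℚ; _+_; _*_; _-_; _⊓_; floor; ceiling; 1ℚ; 0ℚ; _/_)

toℚ : ℤ → ℚ
toℚ z = z / 1

powℚ : ℚ → ℕ → ℚ
powℚ q zero    = 1ℚ
powℚ q (suc k) = q * powℚ q k

dist : ℚ → ℚ
dist x = (x - toℚ (floor x)) ⊓ (toℚ (ceiling x) - x)

distα : ℚ → ℚ → ℚ
distα α x = dist x ⊓ α

inv : (m : ℕ) → .{{_ : NonZero m}} → ℚ
inv m = + 1 / m

-- K-th partial sum of ω_m(x) = Σ_{k≥0} m^{-k} ‖m^k x‖_{1/m}, i.e. Σ_{k<K}
ωPartial : (m : ℕ) → .{{_ : NonZero m}} → ℕ → ℚ → ℚ
ωPartial m zero    x = 0ℚ
ωPartial m (suc K) x =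
  ωPartial m K x + powℚ (inv m) K * distα (inv m) (powℚ (toℚ (+ m)) K * x)

{-# OPTIONS --safe #-}
-- Since ω_m(x) = ‖x‖_{1/m} + ω_m(m x)/m, the identity follows by induction on r once the
-- first terms satisfy it. For r = 1 the first term is ‖n/m‖_{1/m} = 1/m, as m ∤ n, while
-- t and t + 1 are integers. For r ≥ 2, n/m^r = (1 − ρ/m)·t/m^(r−1) + (ρ/m)·(t + 1)/m^(r−1),
-- and ‖·‖_{1/m} is affine between consecutive multiples of 1/m^(r−1) because all its
-- breakpoints are multiples of 1/m. So every partial sum with at least r terms satisfies
-- the identity exactly.

module Submission where

open import Defs
open import Data.Nat as ℕ using (ℕ; NonZero; _∸_)
open import Data.Integer as ℤ using (ℤ; +_)
open import Data.Integer.Divisibility as ℤD using ()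
open import Data.Rational using (ℚ; _+_; _*_; _-_; _<_; ∣_∣; 1ℚ; 0ℚ)
open import Data.Product using (∃)
open import Relation.Nullary using (¬_)
open import Relation.Binary.PropositionalEquality using (_≡_)

open import Data.Nat using (zero; suc; z≤n; s≤s)
import Data.Nat.Properties as ℕP
open import Data.Integer using (-[1+_])
import Data.Integer.Properties as ℤP
open import Data.Integer.DivMod using (_/ℕ_; _%ℕ_; a≡a%ℕn+[a/ℕn]*n; n%ℕd<d)
import Data.Integer.DivMod as ℤDivMod
open import Data.Integer.GCD using (gcd)
open import Data.Rational using (mkℚ; _/_; -_; _⊓_; _≤_; ↥_; ↧_; floor; ceiling; fromℚᵘ; NonNegative)
import Data.Rational.Properties as ℚP
open import Data.Rational.Unnormalised as ℚᵘ using (mkℚᵘ; *≡*)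
import Data.Rational.Unnormalised.Properties as ℚᵘP
open import Data.Product using (_,_; _×_; proj₁; proj₂)
open import Data.Sum using (inj₁; inj₂)
open import Relation.Nullary.Decidable using (dec⇒maybe)
open import Level using (0ℓ)
open import Relation.Nullary using (Dec; yes; no)
open import Relation.Binary.PropositionalEquality
  using (refl; sym; trans; cong; cong₂; subst; subst₂; module ≡-Reasoning)
import Tactic.RingSolver.Core.AlmostCommutativeRing as ACR
open import Tactic.RingSolver using (solve-∀)
import Data.Nat.Tactic.RingSolver as ℕ-Ring
import Data.Integer.Tactic.RingSolver as ℤ-Ring

ℚ-ring : ACR.AlmostCommutativeRing 0ℓ 0ℓ
ℚ-ring = ACR.fromCommutativeRing ℚP.+-*-commutativeRing (λ p → dec⇒maybe (0ℚ ℚP.≟ p))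

fromℚᵘ-homo-+ : ∀ p q → fromℚᵘ (p ℚᵘ.+ q) ≡ fromℚᵘ p + fromℚᵘ q
fromℚᵘ-homo-+ p q = ℚP.toℚᵘ-injective (ℚᵘP.≃-trans (ℚP.toℚᵘ-fromℚᵘ (p ℚᵘ.+ q))
  (ℚᵘP.≃-sym (ℚᵘP.≃-trans (ℚP.toℚᵘ-homo-+ (fromℚᵘ p) (fromℚᵘ q))
    (ℚᵘP.+-cong (ℚP.toℚᵘ-fromℚᵘ p) (ℚP.toℚᵘ-fromℚᵘ q)))))

fromℚᵘ-homo-* : ∀ p q → fromℚᵘ (p ℚᵘ.* q) ≡ fromℚᵘ p * fromℚᵘ q
fromℚᵘ-homo-* p q = ℚP.toℚᵘ-injective (ℚᵘP.≃-trans (ℚP.toℚᵘ-fromℚᵘ (p ℚᵘ.* q))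
  (ℚᵘP.≃-sym (ℚᵘP.≃-trans (ℚP.toℚᵘ-homo-* (fromℚᵘ p) (fromℚᵘ q))
    (ℚᵘP.*-cong (ℚP.toℚᵘ-fromℚᵘ p) (ℚP.toℚᵘ-fromℚᵘ q)))))

fromℚᵘ-homo‿- : ∀ p → fromℚᵘ (ℚᵘ.- p) ≡ - fromℚᵘ p
fromℚᵘ-homo‿- p = ℚP.toℚᵘ-injective (ℚᵘP.≃-trans (ℚP.toℚᵘ-fromℚᵘ (ℚᵘ.- p))
  (ℚᵘP.≃-sym (ℚᵘP.≃-trans (ℚP.toℚᵘ-homo‿- (fromℚᵘ p)) (ℚᵘP.-‿cong (ℚP.toℚᵘ-fromℚᵘ p)))))

toℚ-homo-+ : ∀ a b → toℚ (a ℤ.+ b) ≡ toℚ a + toℚ b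
toℚ-homo-+ a b = trans
  (ℚP.fromℚᵘ-cong {mkℚᵘ (a ℤ.+ b) 0} {mkℚᵘ a 0 ℚᵘ.+ mkℚᵘ b 0} (*≡* (cong (ℤ._* + 1) ℤ-sum)))
  (fromℚᵘ-homo-+ (mkℚᵘ a 0) (mkℚᵘ b 0))
  where
  ℤ-sum : a ℤ.+ b ≡ a ℤ.* + 1 ℤ.+ b ℤ.* + 1
  ℤ-sum = sym (cong₂ ℤ._+_ (ℤP.*-identityʳ a) (ℤP.*-identityʳ b))

toℚ-homo-* : ∀ a b → toℚ (a ℤ.* b) ≡ toℚ a * toℚ b
toℚ-homo-* a b = trans
  (ℚP.fromℚᵘ-cong {mkℚᵘ (a ℤ.* b) 0} {mkℚᵘ a 0 ℚᵘ.* mkℚᵘ b 0} (*≡* refl))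
  (fromℚᵘ-homo-* (mkℚᵘ a 0) (mkℚᵘ b 0))

toℚ-homo‿- : ∀ a → toℚ (ℤ.- a) ≡ - toℚ a
toℚ-homo‿- a = fromℚᵘ-homo‿- (mkℚᵘ a 0)

toℚ-mono-≤ : ∀ {a b} → a ℕ.≤ b → toℚ (+ a) ≤ toℚ (+ b)
toℚ-mono-≤ {a} {b} a≤b = ℚP.toℚᵘ-cancel-≤
  (ℚᵘP.≤-respˡ-≃ (ℚᵘP.≃-sym (ℚP.toℚᵘ-fromℚᵘ (mkℚᵘ (+ a) 0)))
    (ℚᵘP.≤-respʳ-≃ (ℚᵘP.≃-sym (ℚP.toℚᵘ-fromℚᵘ (mkℚᵘ (+ b) 0)))
      (ℚᵘ.*≤* (ℤP.*-monoʳ-≤-nonNeg (+ 1) (ℤ.+≤+ a≤b)))))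

toℚ-homo-⊓ : ∀ a b → toℚ (+ (a ℕ.⊓ b)) ≡ toℚ (+ a) ⊓ toℚ (+ b)
toℚ-homo-⊓ a b with ℕP.≤-total a b
... | inj₁ a≤b = trans (cong (λ x → toℚ (+ x)) (ℕP.m≤n⇒m⊓n≡m a≤b)) (sym (ℚP.p≤q⇒p⊓q≡p (toℚ-mono-≤ a≤b)))
... | inj₂ b≤a = trans (cong (λ x → toℚ (+ x)) (ℕP.m≥n⇒m⊓n≡n b≤a)) (sym (ℚP.p≥q⇒p⊓q≡q (toℚ-mono-≤ b≤a)))

toℚ-+-* : ∀ a b c d → toℚ (+ (a ℕ.* b ℕ.+ c ℕ.* d)) ≡ toℚ (+ a) * toℚ (+ b) + toℚ (+ c) * toℚ (+ d)
toℚ-+-* a b c d = begin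
  toℚ (+ (a ℕ.* b ℕ.+ c ℕ.* d))          ≡⟨ cong toℚ (ℤP.pos-+ (a ℕ.* b) (c ℕ.* d)) ⟩
  toℚ (+ (a ℕ.* b) ℤ.+ + (c ℕ.* d))      ≡⟨ cong toℚ (cong₂ ℤ._+_ (ℤP.pos-* a b) (ℤP.pos-* c d)) ⟩
  toℚ (+ a ℤ.* + b ℤ.+ + c ℤ.* + d)      ≡⟨ toℚ-homo-+ (+ a ℤ.* + b) (+ c ℤ.* + d) ⟩
  toℚ (+ a ℤ.* + b) + toℚ (+ c ℤ.* + d)  ≡⟨ cong₂ _+_ (toℚ-homo-* (+ a) (+ b)) (toℚ-homo-* (+ c) (+ d)) ⟩
  toℚ (+ a) * toℚ (+ b) + toℚ (+ c) * toℚ (+ d) ∎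
  where open ≡-Reasoning

/-as-*inv : ∀ c d .{{_ : NonZero d}} → c / d ≡ toℚ c * inv d
/-as-*inv c (suc d) = trans (ℚP.fromℚᵘ-cong {mkℚᵘ c d} {mkℚᵘ c 0 ℚᵘ.* mkℚᵘ (+ 1) d} (*≡* c*1+d≡[c*1]*1+d))
  (fromℚᵘ-homo-* (mkℚᵘ c 0) (mkℚᵘ (+ 1) d))
  where
  c*1+d≡[c*1]*1+d : c ℤ.* + (1 ℕ.* suc d) ≡ (c ℤ.* + 1) ℤ.* + suc d
  c*1+d≡[c*1]*1+d = cong₂ ℤ._*_ (sym (ℤP.*-identityʳ c)) (cong +_ (ℕP.*-identityˡ (suc d)))

inv-* : ∀ a b {c} .{{_ : NonZero a}} .{{_ : NonZero b}} .{{_ : NonZero c}} →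
  c ≡ a ℕ.* b → inv a * inv b ≡ inv c
inv-* (suc a) (suc b) refl = sym (trans
  (ℚP.fromℚᵘ-cong {mkℚᵘ (+ 1) (b ℕ.+ a ℕ.* suc b)} {mkℚᵘ (+ 1) a ℚᵘ.* mkℚᵘ (+ 1) b} (*≡* refl))
  (fromℚᵘ-homo-* (mkℚᵘ (+ 1) a) (mkℚᵘ (+ 1) b)))

toℚ*inv≡1 : ∀ n .{{_ : NonZero n}} → toℚ (+ n) * inv n ≡ 1ℚ
toℚ*inv≡1 (suc n) = trans (sym (fromℚᵘ-homo-* (mkℚᵘ (+ suc n) 0) (mkℚᵘ (+ 1) n)))
  (ℚP.fromℚᵘ-cong {mkℚᵘ (+ suc n) 0 ℚᵘ.* mkℚᵘ (+ 1) n} {mkℚᵘ (+ 1) 0} (*≡* n*1*1≡1*n))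
  where
  n*1*1≡1*n : (+ suc n ℤ.* + 1) ℤ.* + 1 ≡ + 1 ℤ.* + (1 ℕ.* suc n)
  n*1*1≡1*n = trans (ℤP.*-identityʳ _) (trans (ℤP.*-identityʳ _)
    (trans (cong +_ (sym (ℕP.*-identityˡ (suc n)))) (sym (ℤP.*-identityˡ _))))

inv-nonNeg : ∀ n .{{_ : NonZero n}} → NonNegative (inv n)
inv-nonNeg n = ℚP.normalize-nonNeg 1 n

0≤inv : ∀ n .{{_ : NonZero n}} → 0ℚ ≤ inv n
0≤inv n = ℚP.nonNegative⁻¹ (inv n) {{inv-nonNeg n}}

toℚ-*-inv-cancel : ∀ z n .{{_ : NonZero n}} → toℚ (z ℤ.* + n) * inv n ≡ toℚ z
toℚ-*-inv-cancel z n = begin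
  toℚ (z ℤ.* + n) * inv n       ≡⟨ cong (_* inv n) (toℚ-homo-* z (+ n)) ⟩
  toℚ z * toℚ (+ n) * inv n     ≡⟨ ℚP.*-assoc (toℚ z) _ _ ⟩
  toℚ z * (toℚ (+ n) * inv n)   ≡⟨ cong (toℚ z *_) (toℚ*inv≡1 n) ⟩
  toℚ z * 1ℚ                    ≡⟨ ℚP.*-identityʳ _ ⟩
  toℚ z                         ∎
  where open ≡-Reasoning

toℚ-*-inv-rescale : ∀ z m L {N} .{{_ : NonZero m}} .{{_ : NonZero L}} .{{_ : NonZero N}} →
  N ≡ m ℕ.* L → toℚ z * inv L ≡ toℚ (z ℤ.* + m) * inv N
toℚ-*-inv-rescale z m L {N} N≡m*L = sym (begin
  toℚ (z ℤ.* + m) * inv N                 ≡⟨ cong₂ _*_ (toℚ-homo-* z (+ m)) (sym (inv-* m L N≡m*L)) ⟩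
  toℚ z * toℚ (+ m) * (inv m * inv L)     ≡⟨ regroup (toℚ z) (toℚ (+ m)) (inv m) (inv L) ⟩
  toℚ z * inv L * (toℚ (+ m) * inv m)     ≡⟨ cong (toℚ z * inv L *_) (toℚ*inv≡1 m) ⟩
  toℚ z * inv L * 1ℚ                      ≡⟨ ℚP.*-identityʳ _ ⟩
  toℚ z * inv L                           ∎)
  where
  open ≡-Reasoning
  regroup : ∀ z M μ ι → z * M * (μ * ι) ≡ z * ι * (M * μ)
  regroup = solve-∀ ℚ-ring

inv≡toℚ*inv : ∀ m L {N} .{{_ : NonZero m}} .{{_ : NonZero L}} .{{_ : NonZero N}} →
  N ≡ m ℕ.* L → inv m ≡ toℚ (+ L) * inv N
inv≡toℚ*inv m L N≡m*L = begin
  inv m                        ≡⟨ sym (ℚP.*-identityˡ (inv m)) ⟩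
  toℚ (+ 1) * inv m            ≡⟨ toℚ-*-inv-rescale (+ 1) L m (trans N≡m*L (ℕP.*-comm m L)) ⟩
  toℚ (+ 1 ℤ.* + L) * inv _    ≡⟨ cong (λ z → toℚ z * inv _) (ℤP.*-identityˡ (+ L)) ⟩
  toℚ (+ L) * inv _            ∎
  where open ≡-Reasoning

/ℤ-unique : ∀ a d z → z ℤ.* + suc d ℤ.≤ a → a ℤ.< ℤ.suc z ℤ.* + suc d → a ℤ./ + suc d ≡ z
/ℤ-unique a d z lo hi = ℤP.≤-antisym (squeeze q z q*d≤a hi) (squeeze z q lo a<[1+q]*d)
  where
  q = a ℤ./ + suc d
  q≡ : q ≡ a /ℕ suc d
  q≡ = ℤDivMod.div-pos-is-/ℕ a (suc d)
  q*d≤a : q ℤ.* + suc d ℤ.≤ a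
  q*d≤a = subst (λ x → x ℤ.* + suc d ℤ.≤ a) (sym q≡) (ℤDivMod.[n/ℕd]*d≤n a (suc d))
  a<[1+q]*d : a ℤ.< ℤ.suc q ℤ.* + suc d
  a<[1+q]*d = subst (λ x → a ℤ.< ℤ.suc x ℤ.* + suc d) (sym q≡) (ℤDivMod.n<s[n/ℕd]*d a (suc d))
  squeeze : ∀ x y → x ℤ.* + suc d ℤ.≤ a → a ℤ.< ℤ.suc y ℤ.* + suc d → x ℤ.≤ y
  squeeze x y x*d≤a a<[1+y]*d = subst (x ℤ.≤_) (ℤP.pred-suc y)
    (ℤP.i<j⇒i≤pred[j] {x} {ℤ.suc y}
      (ℤP.*-cancelʳ-<-nonNeg {x} {ℤ.suc y} (+ suc d) (ℤP.≤-<-trans x*d≤a a<[1+y]*d)))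

q*N+N≡[1+q]*N : ∀ q N → q ℤ.* N ℤ.+ N ≡ (+ 1 ℤ.+ q) ℤ.* N
q*N+N≡[1+q]*N = solve-∀ ℤ-Ring.ring

quotient-bounds : ∀ {c q N b} → c ≡ q ℤ.* + N ℤ.+ + b → b ℕ.< N →
  q ℤ.* + N ℤ.≤ c × c ℤ.< ℤ.suc q ℤ.* + N
quotient-bounds {c} {q} {N} {b} refl b<N =
  ℤP.i≤i+j (q ℤ.* + N) (+ b) ,
  subst (c ℤ.<_) (q*N+N≡[1+q]*N q (+ N)) (ℤP.+-monoʳ-< (q ℤ.* + N) (ℤ.+<+ b<N))

floor-unique : ∀ p {g c q N b} → ↥ p ℤ.* g ≡ c → ↧ p ℤ.* g ≡ + N →
  c ≡ q ℤ.* + N ℤ.+ + b → b ℕ.< N → floor p ≡ q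
floor-unique (mkℚ _ d _) {+ 0} {N = suc _} _ ↧g _ _
  with () ← trans (sym (ℤP.*-zeroʳ (+ suc d))) ↧g
floor-unique (mkℚ _ _ _) { -[1+ _ ]} _ () _ _
floor-unique (mkℚ n d _) {g@(+ suc _)} {c} {q} {N} ↥g ↧g c≡ b<N =
  /ℤ-unique n d q (ℤP.*-cancelʳ-≤-pos _ _ g lo) (ℤP.*-cancelʳ-<-nonNeg g hi)
  where
  scale : ∀ x → x ℤ.* + N ≡ x ℤ.* + suc d ℤ.* g
  scale x = trans (cong (x ℤ.*_) (sym ↧g)) (sym (ℤP.*-assoc x (+ suc d) g))
  lo : q ℤ.* + suc d ℤ.* g ℤ.≤ n ℤ.* g
  lo = subst₂ ℤ._≤_ (scale q) (sym ↥g) (proj₁ (quotient-bounds {q = q} c≡ b<N))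
  hi : n ℤ.* g ℤ.< ℤ.suc q ℤ.* + suc d ℤ.* g
  hi = subst₂ ℤ._<_ (sym ↥g) (scale (ℤ.suc q)) (proj₂ (quotient-bounds {q = q} c≡ b<N))

floor-/ : ∀ c N .{{_ : NonZero N}} q b → c ≡ q ℤ.* + N ℤ.+ + b → b ℕ.< N → floor (c / N) ≡ q
floor-/ c N q b = floor-unique (c / N) (ℚP.↥-/ c N) (ℚP.↧-/ c N)

ceiling-as-floor : ∀ p → ceiling p ≡ ℤ.- floor (- p)
ceiling-as-floor (mkℚ _ _ _) = refl

ceiling-/ : ∀ c N .{{_ : NonZero N}} q b e → c ≡ q ℤ.* + N ℤ.+ + b → b ℕ.+ e ≡ N → e ℕ.< N →
  ceiling (c / N) ≡ ℤ.suc q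
ceiling-/ c N q b e c≡ b+e≡N e<N = begin
  ceiling (c / N)            ≡⟨ ceiling-as-floor (c / N) ⟩
  ℤ.- floor (- (c / N))      ≡⟨ cong ℤ.-_ (floor-unique (- (c / N)) ↥-c ↧-c -c≡ e<N) ⟩
  ℤ.- (ℤ.- ℤ.suc q)          ≡⟨ ℤP.neg-involutive _ ⟩
  ℤ.suc q                    ∎
  where
  open ≡-Reasoning
  g = gcd c (+ N)
  ↥-c : ↥ (- (c / N)) ℤ.* g ≡ ℤ.- c
  ↥-c = trans (cong (ℤ._* g) (ℚP.↥-neg (c / N)))
    (trans (sym (ℤP.neg-distribˡ-* (↥ (c / N)) g)) (cong ℤ.-_ (ℚP.↥-/ c N)))
  ↧-c : ↧ (- (c / N)) ℤ.* g ≡ + N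
  ↧-c = trans (cong (ℤ._* g) (ℚP.↧-neg (c / N))) (ℚP.↧-/ c N)
  reflect : ∀ q b e → ℤ.- (q ℤ.* (b ℤ.+ e) ℤ.+ b) ≡ ℤ.- (+ 1 ℤ.+ q) ℤ.* (b ℤ.+ e) ℤ.+ e
  reflect = solve-∀ ℤ-Ring.ring
  -c≡ : ℤ.- c ≡ ℤ.- ℤ.suc q ℤ.* + N ℤ.+ + e
  -c≡ = begin
    ℤ.- c                                       ≡⟨ cong ℤ.-_ c≡ ⟩
    ℤ.- (q ℤ.* + N ℤ.+ + b)                     ≡⟨ cong (λ y → ℤ.- (q ℤ.* y ℤ.+ + b)) (sym b+e≡+N) ⟩
    ℤ.- (q ℤ.* (+ b ℤ.+ + e) ℤ.+ + b)           ≡⟨ reflect q (+ b) (+ e) ⟩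
    ℤ.- ℤ.suc q ℤ.* (+ b ℤ.+ + e) ℤ.+ + e       ≡⟨ cong (λ y → ℤ.- ℤ.suc q ℤ.* y ℤ.+ + e) b+e≡+N ⟩
    ℤ.- ℤ.suc q ℤ.* + N ℤ.+ + e                 ∎
    where
    b+e≡+N : + b ℤ.+ + e ≡ + N
    b+e≡+N = trans (sym (ℤP.pos-+ b e)) (cong +_ b+e≡N)

floor-toℚ : ∀ z → floor (toℚ z) ≡ z
floor-toℚ z = floor-/ z 1 z 0 (sym (trans (ℤP.+-identityʳ _) (ℤP.*-identityʳ z))) (s≤s z≤n)

ceiling-toℚ : ∀ z → ceiling (toℚ z) ≡ z
ceiling-toℚ z = begin
  ceiling (toℚ z)          ≡⟨ ceiling-as-floor (toℚ z) ⟩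
  ℤ.- floor (- toℚ z)      ≡⟨ cong (λ x → ℤ.- floor x) (sym (toℚ-homo‿- z)) ⟩
  ℤ.- floor (toℚ (ℤ.- z))  ≡⟨ cong ℤ.-_ (floor-toℚ (ℤ.- z)) ⟩
  ℤ.- ℤ.- z                ≡⟨ ℤP.neg-involutive z ⟩
  z                        ∎
  where open ≡-Reasoning

distα-toℚ : ∀ α z → 0ℚ ≤ α → distα α (toℚ z) ≡ 0ℚ
distα-toℚ α z 0≤α = begin
  distα α (toℚ z)
    ≡⟨ cong₂ (λ l u → ((toℚ z - toℚ l) ⊓ (toℚ u - toℚ z)) ⊓ α) (floor-toℚ z) (ceiling-toℚ z) ⟩
  ((toℚ z - toℚ z) ⊓ (toℚ z - toℚ z)) ⊓ α  ≡⟨ cong (λ x → (x ⊓ x) ⊓ α) (ℚP.+-inverseʳ (toℚ z)) ⟩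
  (0ℚ ⊓ 0ℚ) ⊓ α                            ≡⟨ ℚP.p≤q⇒p⊓q≡p 0≤α ⟩
  0ℚ                                       ∎
  where open ≡-Reasoning

dist-interior : ∀ N .{{_ : NonZero N}} c q b e → c ≡ q ℤ.* + N ℤ.+ + b → b ℕ.+ e ≡ N →
  b ℕ.< N → e ℕ.< N → dist (toℚ c * inv N) ≡ toℚ (+ (b ℕ.⊓ e)) * inv N
dist-interior N c q b e c≡ b+e≡N b<N e<N = begin
  dist x
    ≡⟨ cong₂ (λ l u → (x - toℚ l) ⊓ (toℚ u - x)) floor-x ceiling-x ⟩
  (x - toℚ q) ⊓ (toℚ (ℤ.suc q) - x)
    ≡⟨ cong₂ _⊓_ above-floor below-ceiling ⟩
  (toℚ (+ b) * i) ⊓ (toℚ (+ e) * i)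
    ≡⟨ sym (ℚP.*-distribʳ-⊓-nonNeg i {{inv-nonNeg N}} (toℚ (+ b)) (toℚ (+ e))) ⟩
  (toℚ (+ b) ⊓ toℚ (+ e)) * i               ≡⟨ cong (_* i) (sym (toℚ-homo-⊓ b e)) ⟩
  toℚ (+ (b ℕ.⊓ e)) * i                     ∎
  where
  open ≡-Reasoning
  i = inv N
  x = toℚ c * i
  x≡c/N : x ≡ c / N
  x≡c/N = sym (/-as-*inv c N)
  floor-x : floor x ≡ q
  floor-x = trans (cong floor x≡c/N) (floor-/ c N q b c≡ b<N)
  ceiling-x : ceiling x ≡ ℤ.suc q
  ceiling-x = trans (cong ceiling x≡c/N) (ceiling-/ c N q b e c≡ b+e≡N e<N)
  c+e≡[1+q]*N : c ℤ.+ + e ≡ ℤ.suc q ℤ.* + N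
  c+e≡[1+q]*N = begin
    c ℤ.+ + e                        ≡⟨ cong (ℤ._+ + e) c≡ ⟩
    q ℤ.* + N ℤ.+ + b ℤ.+ + e        ≡⟨ ℤP.+-assoc (q ℤ.* + N) (+ b) (+ e) ⟩
    q ℤ.* + N ℤ.+ (+ b ℤ.+ + e)
      ≡⟨ cong (ℤ._+_ (q ℤ.* + N)) (trans (sym (ℤP.pos-+ b e)) (cong +_ b+e≡N)) ⟩
    q ℤ.* + N ℤ.+ + N                ≡⟨ q*N+N≡[1+q]*N q (+ N) ⟩
    ℤ.suc q ℤ.* + N                  ∎
  difference : ∀ a d i → (a + d) * i - a * i ≡ d * i
  difference = solve-∀ ℚ-ring
  above-floor : x - toℚ q ≡ toℚ (+ b) * i
  above-floor = begin
    x - toℚ q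
      ≡⟨ cong₂ _-_ (cong (λ c → toℚ c * i) c≡) (sym (toℚ-*-inv-cancel q N)) ⟩
    toℚ (q ℤ.* + N ℤ.+ + b) * i - toℚ (q ℤ.* + N) * i
      ≡⟨ cong (λ y → y * i - toℚ (q ℤ.* + N) * i) (toℚ-homo-+ (q ℤ.* + N) (+ b)) ⟩
    (toℚ (q ℤ.* + N) + toℚ (+ b)) * i - toℚ (q ℤ.* + N) * i
      ≡⟨ difference (toℚ (q ℤ.* + N)) (toℚ (+ b)) i ⟩
    toℚ (+ b) * i                              ∎
  below-ceiling : toℚ (ℤ.suc q) - x ≡ toℚ (+ e) * i
  below-ceiling = begin
    toℚ (ℤ.suc q) - x                 ≡⟨ cong (_- x) (sym (toℚ-*-inv-cancel (ℤ.suc q) N)) ⟩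
    toℚ (ℤ.suc q ℤ.* + N) * i - x     ≡⟨ cong (λ y → toℚ y * i - x) (sym c+e≡[1+q]*N) ⟩
    toℚ (c ℤ.+ + e) * i - x           ≡⟨ cong (λ y → y * i - x) (toℚ-homo-+ c (+ e)) ⟩
    (toℚ c + toℚ (+ e)) * i - x       ≡⟨ difference (toℚ c) (toℚ (+ e)) i ⟩
    toℚ (+ e) * i                     ∎

distα-at-multiple : ∀ m N .{{_ : NonZero m}} .{{_ : NonZero N}} c z →
  c ≡ z ℤ.* + N → distα (inv m) (toℚ c * inv N) ≡ 0ℚ
distα-at-multiple m N c z refl = trans (cong (distα (inv m)) (toℚ-*-inv-cancel z N))
  (distα-toℚ (inv m) z (0≤inv m))

-- The tent b ↦ min (b, N − b, L)

*-<-suc⇒≤ : ∀ m a b → m ℕ.* a ℕ.< m ℕ.* suc b → m ℕ.* a ℕ.≤ m ℕ.* b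
*-<-suc⇒≤ m a b m*a<m*[1+b] = ℕP.*-monoʳ-≤ m (ℕP.≤-pred (ℕP.*-cancelˡ-< m a (suc b) m*a<m*[1+b]))

L+L≤m*L : ∀ {m} L → 2 ℕ.≤ m → L ℕ.+ L ℕ.≤ m ℕ.* L
L+L≤m*L {m} L 2≤m = subst (ℕ._≤ m ℕ.* L) (cong (L ℕ.+_) (ℕP.+-identityʳ L)) (ℕP.*-monoˡ-≤ L 2≤m)

tent : ℕ → ℕ → ℕ → ℕ
tent N L b = (b ℕ.⊓ (N ∸ b)) ℕ.⊓ L

tent-at-N : ∀ N L → tent N L N ≡ 0
tent-at-N N L = trans (cong (λ x → (N ℕ.⊓ x) ℕ.⊓ L) (ℕP.n∸n≡0 N)) (cong (ℕ._⊓ L) (ℕP.⊓-zeroʳ N))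

module _ {N L : ℕ} (L+L≤N : L ℕ.+ L ℕ.≤ N) where

  tent-rising : ∀ {b} → b ℕ.≤ L → tent N L b ≡ b
  tent-rising {b} b≤L = trans (cong (ℕ._⊓ L) (ℕP.m≤n⇒m⊓n≡m b≤N∸b)) (ℕP.m≤n⇒m⊓n≡m b≤L)
    where
    b≤N∸b : b ℕ.≤ N ∸ b
    b≤N∸b = ℕP.m+n≤o⇒m≤o∸n b (ℕP.≤-trans (ℕP.+-mono-≤ b≤L b≤L) L+L≤N)

  tent-flat : ∀ {b} → L ℕ.≤ b → b ℕ.+ L ℕ.≤ N → tent N L b ≡ L
  tent-flat {b} L≤b b+L≤N = ℕP.m≥n⇒m⊓n≡n (ℕP.⊓-glb L≤b L≤N∸b)
    where
    L≤N∸b : L ℕ.≤ N ∸ b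
    L≤N∸b = ℕP.m+n≤o⇒m≤o∸n L (subst (ℕ._≤ N) (ℕP.+-comm b L) b+L≤N)

  tent-falling : ∀ {b d} → b ℕ.+ d ≡ N → d ℕ.≤ L → tent N L b ≡ d
  tent-falling {b} {d} b+d≡N d≤L = begin
    (b ℕ.⊓ (N ∸ b)) ℕ.⊓ L  ≡⟨ cong (λ x → (b ℕ.⊓ x) ℕ.⊓ L) N∸b≡d ⟩
    (b ℕ.⊓ d) ℕ.⊓ L        ≡⟨ cong (ℕ._⊓ L) (ℕP.m≥n⇒m⊓n≡n (ℕP.≤-trans d≤L L≤b)) ⟩
    d ℕ.⊓ L                ≡⟨ ℕP.m≤n⇒m⊓n≡m d≤L ⟩
    d                      ∎
    where
    open ≡-Reasoning
    N∸b≡d : N ∸ b ≡ d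
    N∸b≡d = trans (cong (_∸ b) (sym b+d≡N)) (ℕP.m+n∸m≡n b d)
    L≤b : L ℕ.≤ b
    L≤b = ℕP.+-cancelʳ-≤ L L b (ℕP.≤-trans L+L≤N (subst (ℕ._≤ b ℕ.+ L) b+d≡N (ℕP.+-monoʳ-≤ b d≤L)))

-- f agrees on [x, x + m] with its chord, with denominators cleared:
-- m f(x + ρ) = (m − ρ) f(x) + ρ f(x + m).
AffineOnBlock : (ℕ → ℕ) → ℕ → ℕ → Set
AffineOnBlock f m x = ∀ ρ → ρ ℕ.≤ m → m ℕ.* f (x ℕ.+ ρ) ℕ.+ ρ ℕ.* f x ≡ m ℕ.* f x ℕ.+ ρ ℕ.* f (x ℕ.+ m)

module _ {N L : ℕ} (L+L≤N : L ℕ.+ L ℕ.≤ N) (m x : ℕ) where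

  tent-affineOnBlock-rising : x ℕ.+ m ℕ.≤ L → AffineOnBlock (tent N L) m x
  tent-affineOnBlock-rising x+m≤L ρ ρ≤m = begin
    m ℕ.* tent N L (x ℕ.+ ρ) ℕ.+ ρ ℕ.* tent N L x
      ≡⟨ cong₂ (λ u v → m ℕ.* u ℕ.+ ρ ℕ.* v) (rising (ℕP.+-monoʳ-≤ x ρ≤m)) (rising (ℕP.m≤m+n x m)) ⟩
    m ℕ.* (x ℕ.+ ρ) ℕ.+ ρ ℕ.* x
      ≡⟨ chord m x ρ ⟩
    m ℕ.* x ℕ.+ ρ ℕ.* (x ℕ.+ m)
      ≡⟨ sym (cong₂ (λ u v → m ℕ.* u ℕ.+ ρ ℕ.* v) (rising (ℕP.m≤m+n x m)) (rising ℕP.≤-refl)) ⟩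
    m ℕ.* tent N L x ℕ.+ ρ ℕ.* tent N L (x ℕ.+ m)  ∎
    where
    open ≡-Reasoning
    rising : ∀ {b} → b ℕ.≤ x ℕ.+ m → tent N L b ≡ b
    rising b≤ = tent-rising L+L≤N (ℕP.≤-trans b≤ x+m≤L)
    chord : ∀ m x ρ → m ℕ.* (x ℕ.+ ρ) ℕ.+ ρ ℕ.* x ≡ m ℕ.* x ℕ.+ ρ ℕ.* (x ℕ.+ m)
    chord = solve-∀ ℕ-Ring.ring

  tent-affineOnBlock-flat : L ℕ.≤ x → x ℕ.+ m ℕ.+ L ℕ.≤ N → AffineOnBlock (tent N L) m x
  tent-affineOnBlock-flat L≤x x+m+L≤N ρ ρ≤m = begin
    m ℕ.* tent N L (x ℕ.+ ρ) ℕ.+ ρ ℕ.* tent N L x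
      ≡⟨ cong₂ (λ u v → m ℕ.* u ℕ.+ ρ ℕ.* v) (flat (ℕP.m≤m+n x ρ) (ℕP.+-monoʳ-≤ x ρ≤m))
                                             (flat ℕP.≤-refl (ℕP.m≤m+n x m)) ⟩
    m ℕ.* L ℕ.+ ρ ℕ.* L
      ≡⟨ sym (cong₂ (λ u v → m ℕ.* u ℕ.+ ρ ℕ.* v) (flat ℕP.≤-refl (ℕP.m≤m+n x m))
                                                  (flat (ℕP.m≤m+n x m) ℕP.≤-refl)) ⟩
    m ℕ.* tent N L x ℕ.+ ρ ℕ.* tent N L (x ℕ.+ m)  ∎
    where
    open ≡-Reasoning
    flat : ∀ {b} → x ℕ.≤ b → b ℕ.≤ x ℕ.+ m → tent N L b ≡ L
    flat x≤b b≤ = tent-flat L+L≤N (ℕP.≤-trans L≤x x≤b) (ℕP.≤-trans (ℕP.+-monoˡ-≤ L b≤) x+m+L≤N)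

  tent-affineOnBlock-falling : ∀ e → x ℕ.+ m ℕ.+ e ≡ N → m ℕ.+ e ℕ.≤ L → AffineOnBlock (tent N L) m x
  tent-affineOnBlock-falling e x+m+e≡N m+e≤L ρ ρ≤m with ℕP.m≤n⇒∃[o]m+o≡n ρ≤m
  ... | σ , ρ+σ≡m = begin
    m ℕ.* tent N L (x ℕ.+ ρ) ℕ.+ ρ ℕ.* tent N L x
      ≡⟨ cong₂ (λ u v → m ℕ.* u ℕ.+ ρ ℕ.* v) (tent-falling L+L≤N x+ρ+[σ+e]≡N σ+e≤L)
                                             (tent-falling L+L≤N x+[m+e]≡N m+e≤L) ⟩
    m ℕ.* (σ ℕ.+ e) ℕ.+ ρ ℕ.* (m ℕ.+ e)
      ≡⟨ subst (λ m → m ℕ.* (σ ℕ.+ e) ℕ.+ ρ ℕ.* (m ℕ.+ e) ≡ m ℕ.* (m ℕ.+ e) ℕ.+ ρ ℕ.* e)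
               ρ+σ≡m (chord ρ σ e) ⟩
    m ℕ.* (m ℕ.+ e) ℕ.+ ρ ℕ.* e
      ≡⟨ sym (cong₂ (λ u v → m ℕ.* u ℕ.+ ρ ℕ.* v) (tent-falling L+L≤N x+[m+e]≡N m+e≤L)
               (tent-falling L+L≤N x+m+e≡N (ℕP.≤-trans (ℕP.m≤n+m e m) m+e≤L))) ⟩
    m ℕ.* tent N L x ℕ.+ ρ ℕ.* tent N L (x ℕ.+ m)  ∎
    where
    open ≡-Reasoning
    chord : ∀ ρ σ e → (ρ ℕ.+ σ) ℕ.* (σ ℕ.+ e) ℕ.+ ρ ℕ.* ((ρ ℕ.+ σ) ℕ.+ e)
                      ≡ (ρ ℕ.+ σ) ℕ.* ((ρ ℕ.+ σ) ℕ.+ e) ℕ.+ ρ ℕ.* e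
    chord = solve-∀ ℕ-Ring.ring
    regroup : ∀ x ρ σ e → x ℕ.+ ρ ℕ.+ (σ ℕ.+ e) ≡ x ℕ.+ (ρ ℕ.+ σ) ℕ.+ e
    regroup = solve-∀ ℕ-Ring.ring
    x+ρ+[σ+e]≡N : x ℕ.+ ρ ℕ.+ (σ ℕ.+ e) ≡ N
    x+ρ+[σ+e]≡N = trans (regroup x ρ σ e) (trans (cong (λ y → x ℕ.+ y ℕ.+ e) ρ+σ≡m) x+m+e≡N)
    x+[m+e]≡N : x ℕ.+ (m ℕ.+ e) ≡ N
    x+[m+e]≡N = trans (sym (ℕP.+-assoc x m e)) x+m+e≡N
    σ+e≤L : σ ℕ.+ e ℕ.≤ L
    σ+e≤L = ℕP.≤-trans (ℕP.+-monoˡ-≤ e (subst (σ ℕ.≤_) ρ+σ≡m (ℕP.m≤n+m σ ρ))) m+e≤L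

-- The breakpoints 0, L, N − L, N of the tent are multiples of m, so none lies inside a block.
tent-affineOnBlock : ∀ m L₂ β → 2 ℕ.≤ m → β ℕ.< m ℕ.* L₂ →
  AffineOnBlock (tent (m ℕ.* (m ℕ.* L₂)) (m ℕ.* L₂)) m (m ℕ.* β)
tent-affineOnBlock m L₂ β 2≤m β<L = by-position (x ℕ.+ m ℕ.≤? L) (x ℕ.+ m ℕ.+ L ℕ.≤? N)
  where
  L = m ℕ.* L₂
  N = m ℕ.* L
  x = m ℕ.* β
  L+L≤N : L ℕ.+ L ℕ.≤ N
  L+L≤N = L+L≤m*L L 2≤m
  x+m≡m*[1+β] : x ℕ.+ m ≡ m ℕ.* suc β
  x+m≡m*[1+β] = trans (ℕP.+-comm x m) (sym (ℕP.*-suc m β))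
  x+m≤N : x ℕ.+ m ℕ.≤ N
  x+m≤N = subst (ℕ._≤ N) (sym x+m≡m*[1+β]) (ℕP.*-monoʳ-≤ m β<L)
  e = N ∸ (x ℕ.+ m)
  x+m+e≡N : x ℕ.+ m ℕ.+ e ≡ N
  x+m+e≡N = ℕP.m+[n∸m]≡n x+m≤N
  x+m+L≡m*[1+β+L₂] : ∀ m β L₂ → m ℕ.* β ℕ.+ m ℕ.+ m ℕ.* L₂ ≡ m ℕ.* (1 ℕ.+ (β ℕ.+ L₂))
  x+m+L≡m*[1+β+L₂] = solve-∀ ℕ-Ring.ring
  L≤x : ¬ (x ℕ.+ m ℕ.≤ L) → L ℕ.≤ x
  L≤x x+m≰L = *-<-suc⇒≤ m L₂ β (subst (L ℕ.<_) x+m≡m*[1+β] (ℕP.≰⇒> x+m≰L))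
  m+e≤L : ¬ (x ℕ.+ m ℕ.+ L ℕ.≤ N) → m ℕ.+ e ℕ.≤ L
  m+e≤L x+m+L≰N = ℕP.+-cancelˡ-≤ x (m ℕ.+ e) L (begin
    x ℕ.+ (m ℕ.+ e)    ≡⟨ trans (sym (ℕP.+-assoc x m e)) x+m+e≡N ⟩
    N                  ≤⟨ *-<-suc⇒≤ m L (β ℕ.+ L₂)
                            (subst (N ℕ.<_) (x+m+L≡m*[1+β+L₂] m β L₂) (ℕP.≰⇒> x+m+L≰N)) ⟩
    m ℕ.* (β ℕ.+ L₂)   ≡⟨ ℕP.*-distribˡ-+ m β L₂ ⟩
    x ℕ.+ L            ∎)
    where open ℕP.≤-Reasoning
  by-position : Dec (x ℕ.+ m ℕ.≤ L) → Dec (x ℕ.+ m ℕ.+ L ℕ.≤ N) → AffineOnBlock (tent N L) m x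
  by-position (yes x+m≤L) _ = tent-affineOnBlock-rising L+L≤N m x x+m≤L
  by-position (no x+m≰L) (yes x+m+L≤N) = tent-affineOnBlock-flat L+L≤N m x (L≤x x+m≰L) x+m+L≤N
  by-position (no _) (no x+m+L≰N) = tent-affineOnBlock-falling L+L≤N m x e x+m+e≡N (m+e≤L x+m+L≰N)

distα-tent : ∀ m L {N} .{{_ : NonZero m}} .{{_ : NonZero L}} .{{_ : NonZero N}} c q b →
  N ≡ m ℕ.* L → c ≡ q ℤ.* + N ℤ.+ + b → b ℕ.≤ N →
  distα (inv m) (toℚ c * inv N) ≡ toℚ (+ tent N L b) * inv N
distα-tent m L {N} c q zero _ c≡ _ =
  trans (distα-at-multiple m N c q (trans c≡ (ℤP.+-identityʳ _))) (sym (ℚP.*-zeroˡ (inv N)))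
distα-tent m L {N} c q (suc b) N≡m*L c≡ 1+b≤N with suc b ℕ.≟ N
... | yes refl = begin
  distα (inv m) (toℚ c * inv N)
    ≡⟨ distα-at-multiple m N c (ℤ.suc q) (trans c≡ (q*N+N≡[1+q]*N q (+ N))) ⟩
  0ℚ                             ≡⟨ sym (ℚP.*-zeroˡ (inv N)) ⟩
  toℚ (+ 0) * inv N              ≡⟨ cong (λ k → toℚ (+ k) * inv N) (sym (tent-at-N N L)) ⟩
  toℚ (+ tent N L N) * inv N     ∎
  where open ≡-Reasoning
... | no 1+b≢N = begin
  dist (toℚ c * i) ⊓ inv m
    ≡⟨ cong₂ _⊓_ (dist-interior N c q (suc b) e c≡ (ℕP.m+[n∸m]≡n 1+b≤N) (ℕP.≤∧≢⇒< 1+b≤N 1+b≢N) e<N)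
                 (inv≡toℚ*inv m L N≡m*L) ⟩
  (toℚ (+ (suc b ℕ.⊓ e)) * i) ⊓ (toℚ (+ L) * i)
    ≡⟨ sym (ℚP.*-distribʳ-⊓-nonNeg i {{inv-nonNeg N}} (toℚ (+ (suc b ℕ.⊓ e))) (toℚ (+ L))) ⟩
  (toℚ (+ (suc b ℕ.⊓ e)) ⊓ toℚ (+ L)) * i  ≡⟨ cong (_* i) (sym (toℚ-homo-⊓ (suc b ℕ.⊓ e) L)) ⟩
  toℚ (+ tent N L (suc b)) * i             ∎
  where
  open ≡-Reasoning
  i = inv N
  e = N ∸ suc b
  e<N : e ℕ.< N
  e<N = ℕP.∸-monoʳ-< {N} {suc b} {0} (s≤s z≤n) 1+b≤N

-- Interpolation between m-adic neighbours

affine-combination : ∀ M μ R g₀ g₁ g₂ → M * μ ≡ 1ℚ → M * g₁ + R * g₀ ≡ M * g₀ + R * g₂ →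
  g₁ ≡ (1ℚ - R * μ) * g₀ + R * μ * g₂
affine-combination M μ R g₀ g₁ g₂ M*μ≡1 chord = begin
  g₁                                          ≡⟨ sym (ℚP.*-identityʳ g₁) ⟩
  g₁ * 1ℚ                                     ≡⟨ cong (g₁ *_) (sym M*μ≡1) ⟩
  g₁ * (M * μ)                                ≡⟨ expand g₁ M μ R g₀ ⟩
  μ * (M * g₁ + R * g₀) - R * μ * g₀          ≡⟨ cong (λ y → μ * y - R * μ * g₀) chord ⟩
  μ * (M * g₀ + R * g₂) - R * μ * g₀          ≡⟨ collect M μ R g₀ g₂ ⟩
  (M * μ) * g₀ + R * μ * (g₂ - g₀)            ≡⟨ cong (λ y → y * g₀ + R * μ * (g₂ - g₀)) M*μ≡1 ⟩
  1ℚ * g₀ + R * μ * (g₂ - g₀)                 ≡⟨ regroup μ R g₀ g₂ ⟩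
  (1ℚ - R * μ) * g₀ + R * μ * g₂              ∎
  where
  open ≡-Reasoning
  expand : ∀ g₁ M μ R g₀ → g₁ * (M * μ) ≡ μ * (M * g₁ + R * g₀) - R * μ * g₀
  expand = solve-∀ ℚ-ring
  collect : ∀ M μ R g₀ g₂ → μ * (M * g₀ + R * g₂) - R * μ * g₀ ≡ (M * μ) * g₀ + R * μ * (g₂ - g₀)
  collect = solve-∀ ℚ-ring
  regroup : ∀ μ R g₀ g₂ → 1ℚ * g₀ + R * μ * (g₂ - g₀) ≡ (1ℚ - R * μ) * g₀ + R * μ * g₂
  regroup = solve-∀ ℚ-ring

chord-interpolation : ∀ m .{{_ : NonZero m}} ρ a b c (i : ℚ) →
  m ℕ.* b ℕ.+ ρ ℕ.* a ≡ m ℕ.* a ℕ.+ ρ ℕ.* c →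
  toℚ (+ b) * i ≡ (1ℚ - toℚ (+ ρ) * inv m) * (toℚ (+ a) * i) + toℚ (+ ρ) * inv m * (toℚ (+ c) * i)
chord-interpolation m ρ a b c i chord =
  affine-combination M (inv m) R (A * i) (B * i) (C * i) (toℚ*inv≡1 m) (begin
  M * (B * i) + R * (A * i)      ≡⟨ distribute M B R A i ⟩
  (M * B + R * A) * i            ≡⟨ cong (_* i) (sym (toℚ-+-* m b ρ a)) ⟩
  toℚ (+ (m ℕ.* b ℕ.+ ρ ℕ.* a)) * i ≡⟨ cong (λ k → toℚ (+ k) * i) chord ⟩
  toℚ (+ (m ℕ.* a ℕ.+ ρ ℕ.* c)) * i ≡⟨ cong (_* i) (toℚ-+-* m a ρ c) ⟩
  (M * A + R * C) * i            ≡⟨ sym (distribute M A R C i) ⟩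
  M * (A * i) + R * (C * i)      ∎)
  where
  open ≡-Reasoning
  M = toℚ (+ m)
  R = toℚ (+ ρ)
  A = toℚ (+ a)
  B = toℚ (+ b)
  C = toℚ (+ c)
  distribute : ∀ M B R A i → M * (B * i) + R * (A * i) ≡ (M * B + R * A) * i
  distribute = solve-∀ ℚ-ring

-- n/N = (1 − ρ/m)·t/L + (ρ/m)·(t + 1)/L, and ‖·‖_{1/m} is affine on [t/L, (t + 1)/L] since m ∣ L.
distα-interpolates : ∀ m .{{_ : NonZero m}} → 2 ℕ.≤ m →
  ∀ L₂ {L N} .{{_ : NonZero L}} .{{_ : NonZero N}} → L ≡ m ℕ.* L₂ → N ≡ m ℕ.* L →
  ∀ n t ρ → ρ ℕ.≤ m → n ≡ t ℤ.* + m ℤ.+ + ρ →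
  distα (inv m) (toℚ n * inv N)
    ≡ (1ℚ - toℚ (+ ρ) * inv m) * distα (inv m) (toℚ t * inv L)
      + toℚ (+ ρ) * inv m * distα (inv m) (toℚ (t ℤ.+ + 1) * inv L)
distα-interpolates m 2≤m L₂ {L} {N} refl refl n t ρ ρ≤m refl = begin
  g (toℚ (t ℤ.* + m ℤ.+ + ρ) * i)
    ≡⟨ digit ρ ρ≤m ⟩
  toℚ (+ T (x ℕ.+ ρ)) * i
    ≡⟨ chord-interpolation m ρ (T x) (T (x ℕ.+ ρ)) (T (x ℕ.+ m)) i
         (tent-affineOnBlock m L₂ β 2≤m (n%ℕd<d t L) ρ ρ≤m) ⟩
  (1ℚ - R * μ) * (toℚ (+ T x) * i) + R * μ * (toℚ (+ T (x ℕ.+ m)) * i)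
    ≡⟨ sym (cong₂ (λ u v → (1ℚ - R * μ) * u + R * μ * v) left right) ⟩
  (1ℚ - R * μ) * g (toℚ t * inv L) + R * μ * g (toℚ (t ℤ.+ + 1) * inv L) ∎
  where
  open ≡-Reasoning
  μ = inv m
  g = distα μ
  i = inv N
  R = toℚ (+ ρ)
  T = tent N L
  β = t %ℕ L
  q = t /ℕ L
  x = m ℕ.* β
  regroup : ∀ β q m L j → (β ℤ.+ q ℤ.* L) ℤ.* m ℤ.+ j ≡ q ℤ.* (m ℤ.* L) ℤ.+ (m ℤ.* β ℤ.+ j)
  regroup = solve-∀ ℤ-Ring.ring
  t*m+j≡ : ∀ j → t ℤ.* + m ℤ.+ + j ≡ q ℤ.* + N ℤ.+ + (x ℕ.+ j)
  t*m+j≡ j = begin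
    t ℤ.* + m ℤ.+ + j                           ≡⟨ cong (λ t → t ℤ.* + m ℤ.+ + j) (a≡a%ℕn+[a/ℕn]*n t L) ⟩
    (+ β ℤ.+ q ℤ.* + L) ℤ.* + m ℤ.+ + j         ≡⟨ regroup (+ β) q (+ m) (+ L) (+ j) ⟩
    q ℤ.* (+ m ℤ.* + L) ℤ.+ (+ m ℤ.* + β ℤ.+ + j)
      ≡⟨ sym (cong₂ (λ u v → q ℤ.* u ℤ.+ v) (ℤP.pos-* m L)
               (trans (ℤP.pos-+ x j) (cong (ℤ._+ + j) (ℤP.pos-* m β)))) ⟩
    q ℤ.* + N ℤ.+ + (x ℕ.+ j)                   ∎
  digit : ∀ j → j ℕ.≤ m → g (toℚ (t ℤ.* + m ℤ.+ + j) * i) ≡ toℚ (+ T (x ℕ.+ j)) * i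
  digit j j≤m = distα-tent m L (t ℤ.* + m ℤ.+ + j) q (x ℕ.+ j) refl (t*m+j≡ j) x+j≤N
    where
    x+j≤N : x ℕ.+ j ℕ.≤ N
    x+j≤N = ℕP.≤-trans (ℕP.+-monoʳ-≤ x j≤m)
      (subst (ℕ._≤ N) (trans (ℕP.*-suc m β) (ℕP.+-comm m x)) (ℕP.*-monoʳ-≤ m (n%ℕd<d t L)))
  left : g (toℚ t * inv L) ≡ toℚ (+ T x) * i
  left = begin
    g (toℚ t * inv L)                      ≡⟨ cong g (toℚ-*-inv-rescale t m L refl) ⟩
    g (toℚ (t ℤ.* + m) * i)
      ≡⟨ cong (λ c → g (toℚ c * i)) (sym (ℤP.+-identityʳ (t ℤ.* + m))) ⟩
    g (toℚ (t ℤ.* + m ℤ.+ + 0) * i)        ≡⟨ digit 0 z≤n ⟩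
    toℚ (+ T (x ℕ.+ 0)) * i                ≡⟨ cong (λ b → toℚ (+ T b) * i) (ℕP.+-identityʳ x) ⟩
    toℚ (+ T x) * i                        ∎
  right : g (toℚ (t ℤ.+ + 1) * inv L) ≡ toℚ (+ T (x ℕ.+ m)) * i
  right = begin
    g (toℚ (t ℤ.+ + 1) * inv L)            ≡⟨ cong g (toℚ-*-inv-rescale (t ℤ.+ + 1) m L refl) ⟩
    g (toℚ ((t ℤ.+ + 1) ℤ.* + m) * i)      ≡⟨ cong (λ c → g (toℚ c * i)) (step t (+ m)) ⟩
    g (toℚ (t ℤ.* + m ℤ.+ + m) * i)        ≡⟨ digit m ℕP.≤-refl ⟩
    toℚ (+ T (x ℕ.+ m)) * i                ∎
    where
    step : ∀ t m → (t ℤ.+ + 1) ℤ.* m ≡ t ℤ.* m ℤ.+ m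
    step = solve-∀ ℤ-Ring.ring

-- Partial sums of ω_m

module _ (m : ℕ) .{{_ : NonZero m}} where

  private
    μ = inv m
    M = toℚ (+ m)
    ω = ωPartial m
    g = distα μ
    P = powℚ μ

  ωPartial-unfold : ∀ K x → ωPartial m (suc K) x ≡ distα μ x + μ * ωPartial m K (M * x)
  ωPartial-unfold zero x = begin
    0ℚ + 1ℚ * distα μ (1ℚ * x)  ≡⟨ cong (λ y → 0ℚ + 1ℚ * distα μ y) (ℚP.*-identityˡ x) ⟩
    0ℚ + 1ℚ * distα μ x         ≡⟨ first-term (distα μ x) μ ⟩
    distα μ x + μ * 0ℚ          ∎
    where
    open ≡-Reasoning
    first-term : ∀ a u → 0ℚ + 1ℚ * a ≡ a + u * 0ℚ
    first-term = solve-∀ ℚ-ring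
  ωPartial-unfold (suc K) x = begin
    ωPartial m (suc K) x + μ * powℚ μ K * distα μ (M * powℚ M K * x)
      ≡⟨ cong₂ (λ a y → a + μ * powℚ μ K * distα μ y) (ωPartial-unfold K x) (shift M (powℚ M K) x) ⟩
    distα μ x + μ * ωPartial m K (M * x) + μ * powℚ μ K * distα μ (powℚ M K * (M * x))
      ≡⟨ factor (distα μ x) μ (ωPartial m K (M * x)) (powℚ μ K) (distα μ (powℚ M K * (M * x))) ⟩
    distα μ x + μ * (ωPartial m K (M * x) + powℚ μ K * distα μ (powℚ M K * (M * x))) ∎
    where
    open ≡-Reasoning
    shift : ∀ a b c → a * b * c ≡ b * (a * c)
    shift = solve-∀ ℚ-ring
    factor : ∀ a u b p c → a + u * b + u * p * c ≡ a + u * (b + p * c)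
    factor = solve-∀ ℚ-ring

  ωPartial-toℚ : ∀ K z → ωPartial m K (toℚ z) ≡ 0ℚ
  ωPartial-toℚ zero z = refl
  ωPartial-toℚ (suc K) z = begin
    ωPartial m (suc K) (toℚ z)                 ≡⟨ ωPartial-unfold K (toℚ z) ⟩
    distα μ (toℚ z) + μ * ωPartial m K (M * toℚ z)
      ≡⟨ cong₂ (λ a y → a + μ * ωPartial m K y) (distα-toℚ μ z (0≤inv m))
               (sym (toℚ-homo-* (+ m) z)) ⟩
    0ℚ + μ * ωPartial m K (toℚ (+ m ℤ.* z))    ≡⟨ cong (λ a → 0ℚ + μ * a) (ωPartial-toℚ K (+ m ℤ.* z)) ⟩
    0ℚ + μ * 0ℚ                                ≡⟨ trans (ℚP.+-identityˡ (μ * 0ℚ)) (ℚP.*-zeroʳ μ) ⟩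
    0ℚ                                         ∎
    where open ≡-Reasoning

  powℚ-inv : ∀ j → powℚ μ j ≡ inv (m ℕ.^ j) {{ℕP.m^n≢0 m j}}
  powℚ-inv zero = refl
  powℚ-inv (suc j) = trans (cong (μ *_) (powℚ-inv j)) (inv-* m (m ℕ.^ j) refl)
    where
    instance
      m^j≢0 : NonZero (m ℕ.^ j)
      m^j≢0 = ℕP.m^n≢0 m j
      m^[1+j]≢0 : NonZero (m ℕ.^ suc j)
      m^[1+j]≢0 = ℕP.m^n≢0 m (suc j)

  M*[x*μ^[1+j]]≡x*μ^j : ∀ x j → M * (x * powℚ μ (suc j)) ≡ x * powℚ μ j
  M*[x*μ^[1+j]]≡x*μ^j x j = begin
    M * (x * (μ * powℚ μ j))  ≡⟨ regroup M x μ (powℚ μ j) ⟩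
    x * powℚ μ j * (M * μ)    ≡⟨ cong (x * powℚ μ j *_) (toℚ*inv≡1 m) ⟩
    x * powℚ μ j * 1ℚ         ≡⟨ ℚP.*-identityʳ _ ⟩
    x * powℚ μ j              ∎
    where
    open ≡-Reasoning
    regroup : ∀ M x μ p → M * (x * (μ * p)) ≡ x * p * (M * μ)
    regroup = solve-∀ ℚ-ring

  distα-first-digit : ∀ n t ρ → 1 ℕ.≤ ρ → ρ ℕ.< m → n ≡ t ℤ.* + m ℤ.+ + ρ → distα μ (toℚ n * μ) ≡ μ
  distα-first-digit n t ρ 1≤ρ ρ<m n≡ = begin
    distα μ (toℚ n * μ)          ≡⟨ distα-tent m 1 n t ρ (sym (ℕP.*-identityʳ m)) n≡ (ℕP.<⇒≤ ρ<m) ⟩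
    toℚ (+ tent m 1 ρ) * μ       ≡⟨ cong (λ k → toℚ (+ k) * μ) tent≡1 ⟩
    toℚ (+ 1) * μ                ≡⟨ ℚP.*-identityˡ μ ⟩
    μ                            ∎
    where
    open ≡-Reasoning
    tent≡1 : tent m 1 ρ ≡ 1
    tent≡1 = ℕP.m≥n⇒m⊓n≡n (ℕP.⊓-glb 1≤ρ (ℕP.m<n⇒0<n∸m ρ<m))

  ωPartial-unfold-scaled : ∀ K y j →
    ωPartial m (suc K) (y * powℚ μ (suc j))
      ≡ distα μ (y * powℚ μ (suc j)) + μ * ωPartial m K (y * powℚ μ j)
  ωPartial-unfold-scaled K y j = trans (ωPartial-unfold K (y * powℚ μ (suc j)))
    (cong (λ x → distα μ (y * powℚ μ (suc j)) + μ * ωPartial m K x) (M*[x*μ^[1+j]]≡x*μ^j y j))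

  ωPartial-digit-expansion : 2 ℕ.≤ m → ∀ n t ρ → 1 ℕ.≤ ρ → ρ ℕ.< m → n ≡ t ℤ.* + m ℤ.+ + ρ →
    ∀ s K → suc s ℕ.≤ K →
    ωPartial m K (toℚ n * powℚ μ (suc s))
      ≡ (1ℚ - toℚ (+ ρ) * μ) * ωPartial m K (toℚ t * powℚ μ s)
        + toℚ (+ ρ) * μ * ωPartial m K (toℚ (t ℤ.+ + 1) * powℚ μ s) + powℚ μ (suc s)
  ωPartial-digit-expansion 2≤m n t ρ 1≤ρ ρ<m n≡ zero (suc K) _ = begin
    ω (suc K) (toℚ n * P 1)                 ≡⟨ ωPartial-unfold-scaled K (toℚ n) 0 ⟩
    g (toℚ n * P 1) + μ * ω K (toℚ n * 1ℚ)  ≡⟨ cong₂ (λ a b → a + μ * b) first-digit (vanish K n) ⟩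
    P 1 + μ * 0ℚ                            ≡⟨ pad (P 1) μ R ⟩
    (1ℚ - R * μ) * 0ℚ + R * μ * 0ℚ + P 1
      ≡⟨ sym (cong₂ (λ a b → (1ℚ - R * μ) * a + R * μ * b + P 1)
               (vanish (suc K) t) (vanish (suc K) (t ℤ.+ + 1))) ⟩
    (1ℚ - R * μ) * ω (suc K) (toℚ t * 1ℚ) + R * μ * ω (suc K) (toℚ (t ℤ.+ + 1) * 1ℚ) + P 1 ∎
    where
    open ≡-Reasoning
    R = toℚ (+ ρ)
    vanish : ∀ K z → ω K (toℚ z * 1ℚ) ≡ 0ℚ
    vanish K z = trans (cong (ω K) (ℚP.*-identityʳ (toℚ z))) (ωPartial-toℚ K z)
    first-digit : g (toℚ n * P 1) ≡ P 1
    first-digit = begin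
      g (toℚ n * (μ * 1ℚ))  ≡⟨ cong (λ p → g (toℚ n * p)) (ℚP.*-identityʳ μ) ⟩
      g (toℚ n * μ)         ≡⟨ distα-first-digit n t ρ 1≤ρ ρ<m n≡ ⟩
      μ                     ≡⟨ sym (ℚP.*-identityʳ μ) ⟩
      μ * 1ℚ                ∎
    pad : ∀ p u R → p + u * 0ℚ ≡ (1ℚ - R * u) * 0ℚ + R * u * 0ℚ + p
    pad = solve-∀ ℚ-ring
  ωPartial-digit-expansion 2≤m n t ρ 1≤ρ ρ<m n≡ (suc s) (suc K) (s≤s 1+s≤K) = begin
    ω (suc K) (toℚ n * P (2 ℕ.+ s))
      ≡⟨ ωPartial-unfold-scaled K (toℚ n) (suc s) ⟩
    g (toℚ n * P (2 ℕ.+ s)) + μ * ω K (toℚ n * P (suc s))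
      ≡⟨ cong₂ (λ a b → a + μ * b) interpolate
               (ωPartial-digit-expansion 2≤m n t ρ 1≤ρ ρ<m n≡ s K 1+s≤K) ⟩
    ((1ℚ - R * μ) * g₀ + R * μ * g₁) + μ * ((1ℚ - R * μ) * ω₀ + R * μ * ω₁ + P (suc s))
      ≡⟨ regroup R μ g₀ g₁ ω₀ ω₁ (P (suc s)) ⟩
    (1ℚ - R * μ) * (g₀ + μ * ω₀) + R * μ * (g₁ + μ * ω₁) + P (2 ℕ.+ s)
      ≡⟨ sym (cong₂ (λ a b → (1ℚ - R * μ) * a + R * μ * b + P (2 ℕ.+ s))
               (ωPartial-unfold-scaled K (toℚ t) s) (ωPartial-unfold-scaled K (toℚ (t ℤ.+ + 1)) s)) ⟩
    (1ℚ - R * μ) * ω (suc K) (toℚ t * P (suc s)) + R * μ * ω (suc K) (toℚ (t ℤ.+ + 1) * P (suc s))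
      + P (2 ℕ.+ s) ∎
    where
    open ≡-Reasoning
    R = toℚ (+ ρ)
    g₀ = g (toℚ t * P (suc s))
    g₁ = g (toℚ (t ℤ.+ + 1) * P (suc s))
    ω₀ = ω K (toℚ t * P s)
    ω₁ = ω K (toℚ (t ℤ.+ + 1) * P s)
    instance
      m^[1+s]≢0 : NonZero (m ℕ.^ suc s)
      m^[1+s]≢0 = ℕP.m^n≢0 m (suc s)
      m^[2+s]≢0 : NonZero (m ℕ.^ (2 ℕ.+ s))
      m^[2+s]≢0 = ℕP.m^n≢0 m (2 ℕ.+ s)
    interpolate : g (toℚ n * P (2 ℕ.+ s)) ≡ (1ℚ - R * μ) * g₀ + R * μ * g₁
    interpolate rewrite powℚ-inv (2 ℕ.+ s) | powℚ-inv (suc s) =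
      distα-interpolates m 2≤m (m ℕ.^ s) refl refl n t ρ (ℕP.<⇒≤ ρ<m) n≡
    regroup : ∀ R μ g₀ g₁ ω₀ ω₁ p →
      ((1ℚ - R * μ) * g₀ + R * μ * g₁) + μ * ((1ℚ - R * μ) * ω₀ + R * μ * ω₁ + p)
        ≡ (1ℚ - R * μ) * (g₀ + μ * ω₀) + R * μ * (g₁ + μ * ω₁) + μ * p
    regroup = solve-∀ ℚ-ring

≡⇒∣-∣<ε : ∀ {p q ε} → p ≡ q → 0ℚ < ε → ∣ p - q ∣ < ε
≡⇒∣-∣<ε {p} {ε = ε} refl 0<ε = subst (λ d → ∣ d ∣ < ε) (sym (ℚP.+-inverseʳ p)) 0<ε

lemma1 : (m : ℕ) .{{_ : NonZero m}} → 2 ℕ.≤ m → (r : ℕ) → 1 ℕ.≤ r →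
    (n t : ℤ) (ρ : ℕ) → ¬ (+ m ℤD.∣ n) →
    1 ℕ.≤ ρ → ρ ℕ.≤ m ∸ 1 → n ≡ t ℤ.* + m ℤ.+ + ρ →
    (ε : ℚ) → 0ℚ < ε → ∃ λ N → (K : ℕ) → N ℕ.≤ K →
      ∣ ωPartial m K (toℚ n * powℚ (inv m) r)
        - ((1ℚ - toℚ (+ ρ) * inv m) * ωPartial m K (toℚ t * powℚ (inv m) (r ∸ 1))
           + toℚ (+ ρ) * inv m * ωPartial m K (toℚ (t ℤ.+ + 1) * powℚ (inv m) (r ∸ 1))
           + powℚ (inv m) r) ∣ < ε
lemma1 m 2≤m (suc s) _ n t ρ _ 1≤ρ ρ≤m-1 n≡ ε 0<ε = suc s , λ K 1+s≤K →
  ≡⇒∣-∣<ε (ωPartial-digit-expansion m 2≤m n t ρ 1≤ρ (ℕP.m≤pred[n]⇒suc[m]≤n ρ≤m-1) n≡ s K 1+s≤K) 0<ε
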